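{- Fix $\epsilon>0$ and let $\mathcal{T}$ be any Stabbing Planes refutation of $\mathrm{LOP}_n$. Then, for $n$ large enough, $|\mathcal{T}|\in\Omega(n^{\frac{1-\epsilon}{4}})$.
   Context: $\mathrm{LOP}_n$ (Least Ordering Principle) is the set of integer linear inequalities over variables $P_{i,j}$ ($i\neq j\in[n]$): $P_{i,j}+P_{j,i}=1$ for all $i\neq j$; $P_{i,k}-P_{i,j}-P_{j,k}\geq -1$ for all pairwise distinct $i,j,k\in[n]$; and $\sum_{i\in[n],\, i\neq j}P_{i,j}\geq 1$ for all $j\in[n]$. A Stabbing Planes (SP) refutation of an unsatisfiable set $\mathcal{F}$ of integer linear inequalities in variables $x_1,\dots,x_N$ is a binary tree in which each internal node is labelled by a query $(\mathbf a,b)$ with $\mathbf a\in\mathbb Z^N$, $b\in\mathbb Z$, its two outgoing edges being labelled $\mathbf a\mathbf x\geq b$ and $\mathbf a\mathbf x\leq b-1$, such that for every leaf the linear program consisting of $\mathcal{F}$ together with the inequalities on the edges of the root-to-leaf path is infeasible over $\mathbb R$. $|\mathcal{T}|$ denotes the length, i.e. number of queries.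
   Formalization: The parameter ε ranges over the positive rationals. -}

module Defs where

open import Data.Nat as ℕ using (ℕ)
open import Data.Fin using (Fin; zero; suc)
open import Data.Fin.Properties using (_≟_)
open import Data.Integer as ℤ using (ℤ)
open import Data.Rational using (ℚ; 0ℚ; 1ℚ; _+_; _*_; _-_; _≤_; _/_)
open import Data.Product using (_×_)
open import Data.Unit using (⊤)
open import Data.Empty using (⊥)
open import Data.Bool using (if_then_else_)
open import Relation.Nullary.Decidable using (⌊_⌋)
open import Relation.Binary.PropositionalEquality using (_≡_; _≢_)

toℚ : ℤ → ℚ
toℚ z = z / 1

sumFin : ∀ {n} → (Fin n → ℚ) → ℚ
sumFin {ℕ.zero}  f = 0ℚ
sumFin {ℕ.suc n} f = f zero + sumFin (λ i → f (suc i))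

-- A (real/rational) assignment to the variables P_{i,j}; diagonal entries are
-- never used (they are not variables of LOP_n).
Assignment : ℕ → Set
Assignment n = Fin n → Fin n → ℚ

-- An integer coefficient vector indexed by the variables P_{i,j}, i ≠ j
-- (diagonal coefficients are ignored, so this is exactly ℤ^{n(n-1)}).
Coeffs : ℕ → Set
Coeffs n = Fin n → Fin n → ℤ

linForm : ∀ {n} → Coeffs n → Assignment n → ℚ
linForm a x = sumFin λ i → sumFin λ j →
  if ⌊ i ≟ j ⌋ then 0ℚ else toℚ (a i j) * x i j

LOPsat : ∀ {n} → Assignment n → Set
LOPsat {n} x =
  (∀ (i j : Fin n) → i ≢ j → x i j + x j i ≡ 1ℚ)
  × (∀ (i j k : Fin n) → i ≢ j → j ≢ k → i ≢ k →
       toℚ (ℤ.- ℤ.1ℤ) ≤ x i k - x i j - x j k)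
  × (∀ (j : Fin n) →
       1ℚ ≤ sumFin (λ i → if ⌊ i ≟ j ⌋ then 0ℚ else x i j))

-- Stabbing Planes trees: each internal node is a query (a , b); the left
-- subtree is the branch a·x ≥ b, the right subtree the branch a·x ≤ b - 1.
data SPTree (n : ℕ) : Set where
  leaf : SPTree n
  node : (a : Coeffs n) (b : ℤ) → SPTree n → SPTree n → SPTree n

size : ∀ {n} → SPTree n → ℕ
size leaf           = 0
size (node _ _ l r) = ℕ.suc (size l ℕ.+ size r)

ValidBelow : ∀ {n} → (Assignment n → Set) → SPTree n → Set
ValidBelow C leaf = ∀ x → LOPsat x → C x → ⊥
ValidBelow C (node a b l r) =
  ValidBelow (λ x → C x × (toℚ b ≤ linForm a x)) l
  × ValidBelow (λ x → C x × (linForm a x ≤ toℚ (b ℤ.- ℤ.1ℤ))) r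

IsSPRefutationLOP : ∀ {n} → SPTree n → Set
IsSPRefutationLOP T = ValidBelow (λ _ → ⊤) T

-- An SP refutation of LOP_n in fact needs more than n/3 - 1 queries, which gives the bound for all p, q.
-- Let m = |T| + 1 and split [n] into its residue classes mod m; when 3m ≤ n each has at least three
-- elements.  For a nonempty set S of classes, let x rank the elements so that each class in S is a block
-- of ties (x_ij = ½ inside it) and every other element is a singleton above all blocks.  This x satisfies
-- LOP_n, as every column has two other elements weakly below it, and for an integer query a the number
-- 2(a·x) is congruent mod 2 to the sum over k ∈ S of w_k(a), the total coefficient of a inside class k.
-- The m vectors (w_k(a))_{a ∈ T} in 𝔽₂^|T| are linearly dependent; taking S to be the support of a
-- dependence makes every query integral at x.  An integral point satisfies one branch of every query, so
-- it follows a path to a leaf whose LP it satisfies, which is impossible in a refutation.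

module Submission where

open import Defs
open import Data.Nat as ℕ using (ℕ; _+_; _*_; _^_; _≤_; _<_; zero; suc; s≤s)
open import Data.Product using (Σ; _×_; _,_; proj₁; proj₂; ∃-syntax)
open import Data.Fin using (Fin; zero; suc; toℕ; fromℕ<; punchIn; punchOut)
import Data.Fin.Properties as Fin
open import Data.Integer as ℤ using (ℤ; +_; 0ℤ; 1ℤ)
import Data.Integer.Properties as ℤ
open import Data.Rational as ℚ using (ℚ; mkℚ; 0ℚ; 1ℚ; ½)
import Data.Rational.Properties as ℚ
import Data.Nat.Coprimality as Coprime
open import Data.Nat.DivMod using (_mod_; [m+kn]%n≡m%n; m<n⇒m%n≡m)
open import Data.Integer.DivMod using (_%ℕ_; _/ℕ_; n%ℕd<d; a≡a%ℕn+[a/ℕn]*n)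
open import Data.Integer.Divisibility.Signed using (_∣_; divides; quotient; _∣?_; ∣m∣n⇒∣m+n; ∣n⇒∣m*n)
open import Data.Integer.Tactic.RingSolver using (solve-∀)
open import Data.Nat.Tactic.RingSolver using () renaming (solve-∀ to solve-ℕ)
open import Algebra.Properties.Semiring.Sum ℤ.+-*-semiring
  using (sum-syntax; sum-cong-≗; sum-replicate-zero; ∑-distrib-+; ∑-comm; *-distribˡ-sum; *-distribʳ-sum)
import Data.Vec.Functional as Vector
open import Data.List using (List; []; _∷_; _++_; length; lookup)
import Data.List.Properties as List
open import Data.List.Relation.Unary.All using (All; _∷_)
import Data.List.Relation.Unary.All.Properties as All
open import Data.Bool using (Bool; true; false; if_then_else_)
open import Data.Sum using (_⊎_; inj₁; inj₂)
open import Data.Empty using (⊥; ⊥-elim)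
open import Data.Unit using (tt)
open import Data.Nat.Properties using (<-cmp; <-trans)
import Data.Nat.Properties as ℕ
open import Relation.Binary.Definitions using (Tri; tri<; tri≈; tri>)
open import Relation.Nullary using (¬_; yes; no; Dec)
open import Relation.Nullary.Decidable using (True; toWitness; ⌊_⌋; does; dec-true)
open import Function.Definitions using (Injective)
open import Relation.Binary.PropositionalEquality

-- Parity and linear dependence over 𝔽₂

𝟙 : Bool → ℤ
𝟙 true  = 1ℤ
𝟙 false = 0ℤ

Even : ℤ → Set
Even z = + 2 ∣ z

Odd : ℤ → Set
Odd z = Even (z ℤ.- 1ℤ)

parity : ∀ z → ∃[ b ] Even (z ℤ.- 𝟙 b)
parity z = bit (z %ℕ 2) (n%ℕd<d z 2)
  (divides (z /ℕ 2) (trans (cong (ℤ._- + (z %ℕ 2)) (a≡a%ℕn+[a/ℕn]*n z 2)) (cancel (+ (z %ℕ 2)) (z /ℕ 2))))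
  where
  cancel : ∀ r q → (r ℤ.+ q ℤ.* + 2) ℤ.- r ≡ q ℤ.* + 2
  cancel = solve-∀
  bit : ∀ r → r < 2 → Even (z ℤ.- + r) → ∃[ b ] Even (z ℤ.- 𝟙 b)
  bit 0 _ even = false , even
  bit 1 _ even = true , even
  bit (suc (suc _)) (s≤s (s≤s ())) _

¬even⇒odd : ∀ {z} → ¬ Even z → Odd z
¬even⇒odd {z} ¬even with parity z
... | false , even = ⊥-elim (¬even (subst Even (ℤ.+-identityʳ z) even))
... | true  , odd  = odd

all-even-or-some-odd : ∀ {s} (f : Fin s → ℤ) → (∀ t → Even (f t)) ⊎ ∃[ t ] Odd (f t)
all-even-or-some-odd {s} f with Fin.all? (λ t → + 2 ∣? f t)
... | yes even = inj₁ even
... | no ¬even with Fin.¬∀⟶∃¬ s _ (λ t → + 2 ∣? f t) ¬even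
...   | t , ¬even-t = inj₂ (t , ¬even⇒odd ¬even-t)

subsetSum : ∀ {m} → (Fin m → Bool) → (Fin m → ℤ) → ℤ
subsetSum {m} sel f = ∑[ k < m ] (𝟙 (sel k) ℤ.* f k)

subsetSum-∅ : ∀ {m} (f : Fin m → ℤ) → subsetSum (λ _ → false) f ≡ 0ℤ
subsetSum-∅ {m} f = trans (sum-cong-≗ (λ k → ℤ.*-zeroˡ (f k))) (sum-replicate-zero m)

subsetSum-first : ∀ {m} (f : Fin (suc m) → ℤ) → subsetSum (true Vector.∷ λ _ → false) f ≡ f zero
subsetSum-first f = begin
  1ℤ ℤ.* f zero ℤ.+ subsetSum (λ _ → false) (λ k → f (suc k))
    ≡⟨ cong₂ ℤ._+_ (ℤ.*-identityˡ (f zero)) (subsetSum-∅ (λ k → f (suc k))) ⟩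
  f zero ℤ.+ 0ℤ
    ≡⟨ ℤ.+-identityʳ (f zero) ⟩
  f zero ∎
  where open ≡-Reasoning

subsetSum-affine : ∀ {m} (sel : Fin m → Bool) (x y : Fin m → ℤ) z →
  subsetSum sel (λ k → x k ℤ.+ y k ℤ.* z) ≡ subsetSum sel x ℤ.+ subsetSum sel y ℤ.* z
subsetSum-affine {m} sel x y z = begin
  ∑[ k < m ] (𝟙 (sel k) ℤ.* (x k ℤ.+ y k ℤ.* z))
    ≡⟨ sum-cong-≗ (λ k → expand (𝟙 (sel k)) (x k) (y k) z) ⟩
  ∑[ k < m ] (𝟙 (sel k) ℤ.* x k ℤ.+ 𝟙 (sel k) ℤ.* y k ℤ.* z)
    ≡⟨ ∑-distrib-+ (λ k → 𝟙 (sel k) ℤ.* x k) (λ k → 𝟙 (sel k) ℤ.* y k ℤ.* z) ⟩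
  subsetSum sel x ℤ.+ ∑[ k < m ] (𝟙 (sel k) ℤ.* y k ℤ.* z)
    ≡⟨ cong (λ w → subsetSum sel x ℤ.+ w) (sym (*-distribʳ-sum z (λ k → 𝟙 (sel k) ℤ.* y k))) ⟩
  subsetSum sel x ℤ.+ subsetSum sel y ℤ.* z ∎
  where
  open ≡-Reasoning
  expand : ∀ e a b c → e ℤ.* (a ℤ.+ b ℤ.* c) ≡ e ℤ.* a ℤ.+ e ℤ.* b ℤ.* c
  expand = solve-∀

even-pivot : ∀ b z c → Odd z → Even (c ℤ.- b) → Even (b ℤ.* z ℤ.+ c)
even-pivot b z c odd c≡₂b = subst Even (regroup b z c)
  (∣m∣n⇒∣m+n (∣m∣n⇒∣m+n (∣n⇒∣m*n b odd) c≡₂b) (∣n⇒∣m*n b (divides 1ℤ refl)))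
  where
  regroup : ∀ b z c → b ℤ.* (z ℤ.- 1ℤ) ℤ.+ (c ℤ.- b) ℤ.+ b ℤ.* + 2 ≡ b ℤ.* z ℤ.+ c
  regroup = solve-∀

even-reduced : ∀ b z c a → Even (a ℤ.+ c ℤ.* z) → Even (c ℤ.- b) → Even (b ℤ.* z ℤ.+ a)
even-reduced b z c a even c≡₂b = subst Even (regroup b z c a) (∣m∣n⇒∣m+n even (∣n⇒∣m*n (ℤ.- z) c≡₂b))
  where
  regroup : ∀ b z c a → a ℤ.+ c ℤ.* z ℤ.+ (ℤ.- z) ℤ.* (c ℤ.- b) ≡ b ℤ.* z ℤ.+ a
  regroup = solve-∀

-- One step of Gaussian elimination over 𝔽₂, pivoting on an odd entry v₀(t₀) and dropping coordinate t₀.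
eliminate : ∀ {m s} → (Fin (suc m) → Fin (suc s) → ℤ) → Fin (suc s) → Fin m → Fin s → ℤ
eliminate v t₀ k t = v (suc k) (punchIn t₀ t) ℤ.+ v (suc k) t₀ ℤ.* v zero (punchIn t₀ t)

extend-by-pivot : ∀ {m s} (v : Fin (suc m) → Fin (suc s) → ℤ) {t₀} → Odd (v zero t₀) →
  ∀ sel → (∀ t → Even (subsetSum sel (λ k → eliminate v t₀ k t))) →
  ∃[ b ] ∀ t → Even (subsetSum (b Vector.∷ sel) (λ k → v k t))
extend-by-pivot v {t₀} odd sel even with parity (subsetSum sel (λ k → v (suc k) t₀))
... | b , c≡₂b = b , entry
  where
  off-pivot : ∀ t → Even (subsetSum (b Vector.∷ sel) (λ k → v k (punchIn t₀ t)))
  off-pivot t = even-reduced (𝟙 b) (v zero (punchIn t₀ t)) (subsetSum sel (λ k → v (suc k) t₀))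
    (subsetSum sel (λ k → v (suc k) (punchIn t₀ t)))
    (subst Even (subsetSum-affine sel _ _ _) (even t)) c≡₂b
  entry : ∀ t → Even (subsetSum (b Vector.∷ sel) (λ k → v k t))
  entry t with t₀ Fin.≟ t
  ... | yes refl = even-pivot (𝟙 b) (v zero t₀) _ odd c≡₂b
  ... | no t₀≢t = subst (λ t → Even (subsetSum (b Vector.∷ sel) (λ k → v k t)))
                        (Fin.punchIn-punchOut t₀≢t) (off-pivot (punchOut t₀≢t))

nonempty-even-subsetSum : ∀ {s m} → s < m → (v : Fin m → Fin s → ℤ) →
  ∃[ sel ] (∃[ k ] sel k ≡ true) × (∀ t → Even (subsetSum sel (λ k → v k t)))
nonempty-even-subsetSum {s} {suc m} _ v with all-even-or-some-odd (v zero)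
... | inj₁ even = true Vector.∷ (λ _ → false) , (zero , refl) ,
  λ t → subst Even (sym (subsetSum-first (λ k → v k t))) (even t)
nonempty-even-subsetSum {suc s} {suc m} (s≤s s<m) v | inj₂ (t₀ , odd)
  with nonempty-even-subsetSum s<m (eliminate v t₀)
... | sel , (k , k∈sel) , even with extend-by-pivot v odd sel even
...   | b , even′ = b Vector.∷ sel , (suc k , k∈sel) , even′

toℚ-normal : ∀ z → toℚ z ≡ mkℚ z 0 (Coprime.sym (Coprime.1-coprimeTo ℤ.∣ z ∣))
toℚ-normal (+ n)      = ℚ.normalize-coprime {n} {0} _
toℚ-normal ℤ.-[1+ n ] = cong ℚ.-_ (ℚ.normalize-coprime {suc n} {0} _)

toℚ-+ : ∀ x y → toℚ (x ℤ.+ y) ≡ toℚ x ℚ.+ toℚ y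
toℚ-+ x y rewrite toℚ-normal x | toℚ-normal y =
  sym (cong₂ (λ a b → (a ℤ.+ b) ℚ./ 1) (ℤ.*-identityʳ x) (ℤ.*-identityʳ y))

toℚ-* : ∀ x y → toℚ (x ℤ.* y) ≡ toℚ x ℚ.* toℚ y
toℚ-* x y rewrite toℚ-normal x | toℚ-normal y = refl

toℚ-mono-≤ : ∀ {x y} → x ℤ.≤ y → toℚ x ℚ.≤ toℚ y
toℚ-mono-≤ {x} {y} x≤y rewrite toℚ-normal x | toℚ-normal y =
  ℚ.*≤* (subst₂ ℤ._≤_ (sym (ℤ.*-identityʳ x)) (sym (ℤ.*-identityʳ y)) x≤y)

toℚ-halve : ∀ q → toℚ (q ℤ.* + 2) ℚ.* ½ ≡ toℚ q
toℚ-halve q = begin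
  toℚ (q ℤ.* + 2) ℚ.* ½          ≡⟨ cong (ℚ._* ½) (toℚ-* q (+ 2)) ⟩
  toℚ q ℚ.* toℚ (+ 2) ℚ.* ½      ≡⟨ ℚ.*-assoc (toℚ q) (toℚ (+ 2)) ½ ⟩
  toℚ q ℚ.* 1ℚ                   ≡⟨ ℚ.*-identityʳ (toℚ q) ⟩
  toℚ q ∎
  where open ≡-Reasoning

sumFin-cong : ∀ {m} {f g : Fin m → ℚ} → (∀ i → f i ≡ g i) → sumFin f ≡ sumFin g
sumFin-cong {zero}  f≗g = refl
sumFin-cong {suc m} f≗g = cong₂ ℚ._+_ (f≗g zero) (sumFin-cong (λ i → f≗g (suc i)))

sumFin-toℚ-half : ∀ {m} (f : Fin m → ℤ) → sumFin (λ i → toℚ (f i) ℚ.* ½) ≡ toℚ (∑[ i < m ] f i) ℚ.* ½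
sumFin-toℚ-half {zero}  f = refl
sumFin-toℚ-half {suc m} f = begin
  toℚ (f zero) ℚ.* ½ ℚ.+ sumFin (λ i → toℚ (f (suc i)) ℚ.* ½)
    ≡⟨ cong (toℚ (f zero) ℚ.* ½ ℚ.+_) (sumFin-toℚ-half (λ i → f (suc i))) ⟩
  toℚ (f zero) ℚ.* ½ ℚ.+ toℚ rest ℚ.* ½
    ≡⟨ sym (ℚ.*-distribʳ-+ ½ (toℚ (f zero)) (toℚ rest)) ⟩
  (toℚ (f zero) ℚ.+ toℚ rest) ℚ.* ½
    ≡⟨ cong (ℚ._* ½) (sym (toℚ-+ (f zero) rest)) ⟩
  toℚ (f zero ℤ.+ rest) ℚ.* ½ ∎
  where
  open ≡-Reasoning
  rest = ∑[ i < m ] f (suc i)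

sumFin-nonneg : ∀ {m} (f : Fin m → ℚ) → (∀ i → 0ℚ ℚ.≤ f i) → 0ℚ ℚ.≤ sumFin f
sumFin-nonneg {zero}  f f≥0 = ℚ.≤-refl
sumFin-nonneg {suc m} f f≥0 = subst (ℚ._≤ sumFin f) (ℚ.+-identityˡ 0ℚ)
  (ℚ.+-mono-≤ (f≥0 zero) (sumFin-nonneg (λ i → f (suc i)) (λ i → f≥0 (suc i))))

term≤sumFin : ∀ {m} (f : Fin m → ℚ) → (∀ i → 0ℚ ℚ.≤ f i) → ∀ i → f i ℚ.≤ sumFin f
term≤sumFin f f≥0 zero = subst (ℚ._≤ sumFin f) (ℚ.+-identityʳ (f zero))
  (ℚ.+-mono-≤ (ℚ.≤-refl {f zero}) (sumFin-nonneg (λ i → f (suc i)) (λ i → f≥0 (suc i))))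
term≤sumFin f f≥0 (suc i) = subst (ℚ._≤ sumFin f) (ℚ.+-identityˡ (f (suc i)))
  (ℚ.+-mono-≤ (f≥0 zero) (term≤sumFin (λ i → f (suc i)) (λ i → f≥0 (suc i)) i))

two-terms≤sumFin : ∀ {m} (f : Fin m → ℚ) → (∀ i → 0ℚ ℚ.≤ f i) →
  ∀ {i j} → i ≢ j → f i ℚ.+ f j ℚ.≤ sumFin f
two-terms≤sumFin f f≥0 {zero}  {zero}  i≢j = ⊥-elim (i≢j refl)
two-terms≤sumFin f f≥0 {zero}  {suc j} _ =
  ℚ.+-mono-≤ (ℚ.≤-refl {f zero}) (term≤sumFin (λ i → f (suc i)) (λ i → f≥0 (suc i)) j)
two-terms≤sumFin f f≥0 {suc i} {zero}  _ = subst (ℚ._≤ sumFin f) (ℚ.+-comm (f zero) (f (suc i)))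
  (ℚ.+-mono-≤ (ℚ.≤-refl {f zero}) (term≤sumFin (λ i → f (suc i)) (λ i → f≥0 (suc i)) i))
two-terms≤sumFin f f≥0 {suc i} {suc j} i≢j = subst (ℚ._≤ sumFin f) (ℚ.+-identityˡ (f (suc i) ℚ.+ f (suc j)))
  (ℚ.+-mono-≤ (f≥0 zero) (two-terms≤sumFin (λ i → f (suc i)) (λ i → f≥0 (suc i)) (λ i≡j → i≢j (cong suc i≡j))))

-- Points of LOP_n given by rankings

≤-eval : ∀ {p q} {_ : True (p ℚ.≤? q)} → p ℚ.≤ q
≤-eval {_} {_} {p≤q} = toWitness p≤q

orderWeight : ∀ {A B C : Set} → Tri A B C → ℚ
orderWeight (tri< _ _ _) = 1ℚ
orderWeight (tri≈ _ _ _) = ½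
orderWeight (tri> _ _ _) = 0ℚ

rankPoint : ∀ {n} → (Fin n → ℕ) → Assignment n
rankPoint g i j = orderWeight (<-cmp (g i) (g j))

orderWeight-nonneg : ∀ {A B C : Set} (t : Tri A B C) → 0ℚ ℚ.≤ orderWeight t
orderWeight-nonneg (tri< _ _ _) = ≤-eval
orderWeight-nonneg (tri≈ _ _ _) = ≤-eval
orderWeight-nonneg (tri> _ _ _) = ≤-eval

orderWeight-complement : ∀ a b → orderWeight (<-cmp a b) ℚ.+ orderWeight (<-cmp b a) ≡ 1ℚ
orderWeight-complement a b with <-cmp a b | <-cmp b a
... | tri< _   _   _   | tri> _ _ _     = refl
... | tri≈ _   _   _   | tri≈ _ _ _     = refl
... | tri> _   _   _   | tri< _ _ _     = refl
... | tri< _   _   a≯b | tri< b<a _ _   = ⊥-elim (a≯b b<a)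
... | tri< _   a≢b _   | tri≈ _ b≡a _   = ⊥-elim (a≢b (sym b≡a))
... | tri≈ ¬a<b _  _   | tri> _ _ a<b   = ⊥-elim (¬a<b a<b)
... | tri≈ _   _   a≯b | tri< b<a _ _   = ⊥-elim (a≯b b<a)
... | tri> _   a≢b _   | tri≈ _ b≡a _   = ⊥-elim (a≢b (sym b≡a))
... | tri> ¬a<b _  _   | tri> _ _ a<b   = ⊥-elim (¬a<b a<b)

orderWeight-transitive : ∀ a b c →
  toℚ (ℤ.- 1ℤ) ℚ.≤ orderWeight (<-cmp a c) ℚ.- orderWeight (<-cmp a b) ℚ.- orderWeight (<-cmp b c)
orderWeight-transitive a b c with <-cmp a b | <-cmp b c | <-cmp a c
... | tri< a<b _ _ | tri< b<c _ _ | tri≈ ¬a<c _ _ = ⊥-elim (¬a<c (<-trans a<b b<c))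
... | tri< a<b _ _ | tri< b<c _ _ | tri> ¬a<c _ _ = ⊥-elim (¬a<c (<-trans a<b b<c))
... | tri< a<b _ _ | tri≈ _ b≡c _ | tri> ¬a<c _ _ = ⊥-elim (¬a<c (subst (a <_) b≡c a<b))
... | tri≈ _ a≡b _ | tri< b<c _ _ | tri> ¬a<c _ _ = ⊥-elim (¬a<c (subst (_< c) (sym a≡b) b<c))
... | tri< _ _ _ | tri< _ _ _ | tri< _ _ _ = ≤-eval
... | tri< _ _ _ | tri≈ _ _ _ | tri< _ _ _ = ≤-eval
... | tri< _ _ _ | tri≈ _ _ _ | tri≈ _ _ _ = ≤-eval
... | tri< _ _ _ | tri> _ _ _ | tri< _ _ _ = ≤-eval
... | tri< _ _ _ | tri> _ _ _ | tri≈ _ _ _ = ≤-eval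
... | tri< _ _ _ | tri> _ _ _ | tri> _ _ _ = ≤-eval
... | tri≈ _ _ _ | tri< _ _ _ | tri< _ _ _ = ≤-eval
... | tri≈ _ _ _ | tri< _ _ _ | tri≈ _ _ _ = ≤-eval
... | tri≈ _ _ _ | tri≈ _ _ _ | tri< _ _ _ = ≤-eval
... | tri≈ _ _ _ | tri≈ _ _ _ | tri≈ _ _ _ = ≤-eval
... | tri≈ _ _ _ | tri≈ _ _ _ | tri> _ _ _ = ≤-eval
... | tri≈ _ _ _ | tri> _ _ _ | tri< _ _ _ = ≤-eval
... | tri≈ _ _ _ | tri> _ _ _ | tri≈ _ _ _ = ≤-eval
... | tri≈ _ _ _ | tri> _ _ _ | tri> _ _ _ = ≤-eval
... | tri> _ _ _ | tri< _ _ _ | tri< _ _ _ = ≤-eval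
... | tri> _ _ _ | tri< _ _ _ | tri≈ _ _ _ = ≤-eval
... | tri> _ _ _ | tri< _ _ _ | tri> _ _ _ = ≤-eval
... | tri> _ _ _ | tri≈ _ _ _ | tri< _ _ _ = ≤-eval
... | tri> _ _ _ | tri≈ _ _ _ | tri≈ _ _ _ = ≤-eval
... | tri> _ _ _ | tri≈ _ _ _ | tri> _ _ _ = ≤-eval
... | tri> _ _ _ | tri> _ _ _ | tri< _ _ _ = ≤-eval
... | tri> _ _ _ | tri> _ _ _ | tri≈ _ _ _ = ≤-eval
... | tri> _ _ _ | tri> _ _ _ | tri> _ _ _ = ≤-eval

½≤orderWeight : ∀ {a b} → a ≤ b → ½ ℚ.≤ orderWeight (<-cmp a b)
½≤orderWeight {a} {b} a≤b with <-cmp a b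
... | tri< _ _ _   = ≤-eval
... | tri≈ _ _ _   = ≤-eval
... | tri> _ _ b<a = ⊥-elim (ℕ.<⇒≱ b<a a≤b)

two-avoiding : ∀ {n} (e : Fin 3 → Fin n) → Injective _≡_ _≡_ e → ∀ j →
  ∃[ r ] ∃[ r′ ] r ≢ r′ × e r ≢ j × e r′ ≢ j
two-avoiding e e-inj j with e zero Fin.≟ j | e (suc zero) Fin.≟ j
... | yes refl | _ =
  suc zero , suc (suc zero) , (λ ()) ,
  (λ e₁≡e₀ → Fin.0≢1+n (sym (e-inj e₁≡e₀))) , (λ e₂≡e₀ → Fin.0≢1+n (sym (e-inj e₂≡e₀)))
... | no e₀≢j | yes refl =
  zero , suc (suc zero) , (λ ()) , e₀≢j , (λ e₂≡e₁ → Fin.0≢1+n (sym (Fin.suc-injective (e-inj e₂≡e₁))))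
... | no e₀≢j | no e₁≢j = zero , suc zero , (λ ()) , e₀≢j , e₁≢j

rankPoint-column : ∀ {n} (g : Fin n → ℕ) j {i i′} → i ≢ i′ → i ≢ j → i′ ≢ j → g i ≤ g j → g i′ ≤ g j →
  1ℚ ℚ.≤ sumFin (λ k → if ⌊ k Fin.≟ j ⌋ then 0ℚ else rankPoint g k j)
rankPoint-column g j {i} {i′} i≢i′ i≢j i′≢j gi≤gj gi′≤gj =
  ℚ.≤-trans (ℚ.+-mono-≤ (½≤entry i≢j gi≤gj) (½≤entry i′≢j gi′≤gj)) (two-terms≤sumFin entry entry-nonneg i≢i′)
  where
  entry : Fin _ → ℚ
  entry k = if ⌊ k Fin.≟ j ⌋ then 0ℚ else rankPoint g k j
  entry-nonneg : ∀ k → 0ℚ ℚ.≤ entry k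
  entry-nonneg k with k Fin.≟ j
  ... | yes _ = ℚ.≤-refl
  ... | no _  = orderWeight-nonneg (<-cmp (g k) (g j))
  ½≤entry : ∀ {k} → k ≢ j → g k ≤ g j → ½ ℚ.≤ entry k
  ½≤entry {k} k≢j gk≤gj with k Fin.≟ j
  ... | yes k≡j = ⊥-elim (k≢j k≡j)
  ... | no _    = ½≤orderWeight gk≤gj

rankPoint-LOPsat : ∀ {n} (g : Fin n → ℕ) →
  (∀ j → ∃[ e ] Injective _≡_ _≡_ e × (∀ r → g (e r) ≤ g j)) → LOPsat (rankPoint g)
rankPoint-LOPsat g three-below =
  (λ i j _ → orderWeight-complement (g i) (g j)) ,
  (λ i j k _ _ _ → orderWeight-transitive (g i) (g j) (g k)) ,
  column
  where
  column : ∀ j → 1ℚ ℚ.≤ sumFin (λ k → if ⌊ k Fin.≟ j ⌋ then 0ℚ else rankPoint g k j)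
  column j with three-below j
  ... | e , e-inj , below with two-avoiding e e-inj j
  ...   | r , r′ , r≢r′ , er≢j , er′≢j =
    rankPoint-column g j (λ er≡er′ → r≢r′ (e-inj er≡er′)) er≢j er′≢j (below r) (below r′)

-- Integrality of queries at ranking points

even-∑-diff : ∀ {m} (f g : Fin m → ℤ) → (∀ i → Even (f i ℤ.- g i)) → Even (∑[ i < m ] f i ℤ.- ∑[ i < m ] g i)
even-∑-diff {zero}  f g _    = divides 0ℤ refl
even-∑-diff {suc m} f g even = subst Even (regroup (f zero) (g zero) (∑[ i < m ] f (suc i)) (∑[ i < m ] g (suc i)))
  (∣m∣n⇒∣m+n (even zero) (even-∑-diff (λ i → f (suc i)) (λ i → g (suc i)) (λ i → even (suc i))))
  where
  regroup : ∀ a b c d → (a ℤ.- b) ℤ.+ (c ℤ.- d) ≡ (a ℤ.+ c) ℤ.- (b ℤ.+ d)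
  regroup = solve-∀

even-by-congruence : ∀ {x y} → Even (x ℤ.- y) → Even y → Even x
even-by-congruence {x} {y} x≡₂y even-y = subst Even (regroup x y) (∣m∣n⇒∣m+n x≡₂y even-y)
  where
  regroup : ∀ x y → (x ℤ.- y) ℤ.+ y ≡ x
  regroup = solve-∀

twiceWeight : ∀ {A B C : Set} → Tri A B C → ℤ
twiceWeight (tri< _ _ _) = + 2
twiceWeight (tri≈ _ _ _) = + 1
twiceWeight (tri> _ _ _) = + 0

tieWeight : ∀ {A B C : Set} → Tri A B C → ℤ
tieWeight (tri< _ _ _) = + 0
tieWeight (tri≈ _ _ _) = + 1
tieWeight (tri> _ _ _) = + 0

twiceWeight≡₂tieWeight : ∀ {A B C : Set} (t : Tri A B C) → Even (twiceWeight t ℤ.- tieWeight t)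
twiceWeight≡₂tieWeight (tri< _ _ _) = divides 1ℤ refl
twiceWeight≡₂tieWeight (tri≈ _ _ _) = divides 0ℤ refl
twiceWeight≡₂tieWeight (tri> _ _ _) = divides 0ℤ refl

offDiagonal : ∀ {n} → Coeffs n → Fin n → Fin n → ℤ
offDiagonal a i j = if ⌊ i Fin.≟ j ⌋ then 0ℤ else a i j

linFormℤ : ∀ {n} → Coeffs n → (Fin n → Fin n → ℤ) → ℤ
linFormℤ {n} a y = ∑[ i < n ] ∑[ j < n ] (offDiagonal a i j ℤ.* y i j)

twiceRankPoint : ∀ {n} → (Fin n → ℕ) → Fin n → Fin n → ℤ
twiceRankPoint g i j = twiceWeight (<-cmp (g i) (g j))

ties : ∀ {n} → (Fin n → ℕ) → Fin n → Fin n → ℤ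
ties g i j = tieWeight (<-cmp (g i) (g j))

linForm-rankPoint : ∀ {n} (g : Fin n → ℕ) (a : Coeffs n) →
  linForm a (rankPoint g) ≡ toℚ (linFormℤ a (twiceRankPoint g)) ℚ.* ½
linForm-rankPoint {n} g a = trans
  (sumFin-cong λ i → trans (sumFin-cong λ j → term (i Fin.≟ j) (a i j) (<-cmp (g i) (g j)))
                           (sumFin-toℚ-half (λ j → offDiagonal a i j ℤ.* twiceRankPoint g i j)))
  (sumFin-toℚ-half (λ i → ∑[ j < n ] (offDiagonal a i j ℤ.* twiceRankPoint g i j)))
  where
  term : ∀ {P A B C : Set} (d : Dec P) z (t : Tri A B C) →
    (if ⌊ d ⌋ then 0ℚ else toℚ z ℚ.* orderWeight t) ≡ toℚ ((if ⌊ d ⌋ then 0ℤ else z) ℤ.* twiceWeight t) ℚ.* ½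
  term (yes _) z (tri< _ _ _) = refl
  term (yes _) z (tri≈ _ _ _) = refl
  term (yes _) z (tri> _ _ _) = refl
  term (no _)  z t = begin
    toℚ z ℚ.* orderWeight t                 ≡⟨ cong (toℚ z ℚ.*_) (twice t) ⟩
    toℚ z ℚ.* (toℚ (twiceWeight t) ℚ.* ½)   ≡⟨ sym (ℚ.*-assoc (toℚ z) _ ½) ⟩
    toℚ z ℚ.* toℚ (twiceWeight t) ℚ.* ½     ≡⟨ cong (ℚ._* ½) (sym (toℚ-* z (twiceWeight t))) ⟩
    toℚ (z ℤ.* twiceWeight t) ℚ.* ½ ∎
    where
    open ≡-Reasoning
    twice : ∀ {A B C : Set} (t : Tri A B C) → orderWeight t ≡ toℚ (twiceWeight t) ℚ.* ½
    twice (tri< _ _ _) = refl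
    twice (tri≈ _ _ _) = refl
    twice (tri> _ _ _) = refl

linFormℤ-≡₂ : ∀ {n} (a : Coeffs n) {y y′ : Fin n → Fin n → ℤ} → (∀ i j → Even (y i j ℤ.- y′ i j)) →
  Even (linFormℤ a y ℤ.- linFormℤ a y′)
linFormℤ-≡₂ {n} a {y} {y′} y≡₂y′ =
  even-∑-diff (λ i → ∑[ j < n ] (offDiagonal a i j ℤ.* y i j)) (λ i → ∑[ j < n ] (offDiagonal a i j ℤ.* y′ i j)) λ i →
  even-∑-diff (λ j → offDiagonal a i j ℤ.* y i j) (λ j → offDiagonal a i j ℤ.* y′ i j) λ j →
  subst Even (factor (offDiagonal a i j) (y i j) (y′ i j)) (∣n⇒∣m*n (offDiagonal a i j) (y≡₂y′ i j))
  where
  factor : ∀ a b c → a ℤ.* (b ℤ.- c) ≡ a ℤ.* b ℤ.- a ℤ.* c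
  factor = solve-∀

rankPoint-integral : ∀ {n} (g : Fin n → ℕ) (a : Coeffs n) → Even (linFormℤ a (ties g)) →
  ∃[ w ] linForm a (rankPoint g) ≡ toℚ w
rankPoint-integral g a even-ties = quotient even-twice , (begin
  linForm a (rankPoint g)                              ≡⟨ linForm-rankPoint g a ⟩
  toℚ (linFormℤ a (twiceRankPoint g)) ℚ.* ½            ≡⟨ cong (λ z → toℚ z ℚ.* ½) (_∣_.equality even-twice) ⟩
  toℚ (quotient even-twice ℤ.* + 2) ℚ.* ½              ≡⟨ toℚ-halve (quotient even-twice) ⟩
  toℚ (quotient even-twice) ∎)
  where
  open ≡-Reasoning
  even-twice : Even (linFormℤ a (twiceRankPoint g))
  even-twice = even-by-congruence
    (linFormℤ-≡₂ a (λ i j → twiceWeight≡₂tieWeight (<-cmp (g i) (g j)))) even-ties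

-- Collapsing residue classes

∑-δ : ∀ {m} (c : Fin m) (f : Fin m → ℤ) → ∑[ k < m ] (𝟙 (does (c Fin.≟ k)) ℤ.* f k) ≡ f c
∑-δ {suc m} zero f = begin
  1ℤ ℤ.* f zero ℤ.+ ∑[ k < m ] (0ℤ ℤ.* f (suc k))   ≡⟨ cong₂ ℤ._+_ (ℤ.*-identityˡ (f zero)) (subsetSum-∅ (λ k → f (suc k))) ⟩
  f zero ℤ.+ 0ℤ                                      ≡⟨ ℤ.+-identityʳ (f zero) ⟩
  f zero ∎
  where open ≡-Reasoning
∑-δ {suc m} (suc c) f = trans (ℤ.+-identityˡ _) (∑-δ c (λ k → f (suc k)))

linFormℤ-subsetSum : ∀ {n m} (a : Coeffs n) (sel : Fin m → Bool) (y : Fin m → Fin n → Fin n → ℤ) →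
  subsetSum sel (λ k → linFormℤ a (y k)) ≡ linFormℤ a (λ i j → subsetSum sel (λ k → y k i j))
linFormℤ-subsetSum {n} {m} a sel y = begin
  ∑[ k < m ] (𝟙 (sel k) ℤ.* ∑[ i < n ] ∑[ j < n ] term k i j)
    ≡⟨ sum-cong-≗ (λ k → trans (*-distribˡ-sum (𝟙 (sel k)) (λ i → ∑[ j < n ] term k i j))
                                 (sum-cong-≗ λ i → *-distribˡ-sum (𝟙 (sel k)) (term k i))) ⟩
  ∑[ k < m ] ∑[ i < n ] ∑[ j < n ] (𝟙 (sel k) ℤ.* term k i j)
    ≡⟨ ∑-comm (λ k i → ∑[ j < n ] (𝟙 (sel k) ℤ.* term k i j)) ⟩
  ∑[ i < n ] ∑[ k < m ] ∑[ j < n ] (𝟙 (sel k) ℤ.* term k i j)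
    ≡⟨ sum-cong-≗ (λ i → ∑-comm (λ k j → 𝟙 (sel k) ℤ.* term k i j)) ⟩
  ∑[ i < n ] ∑[ j < n ] ∑[ k < m ] (𝟙 (sel k) ℤ.* term k i j)
    ≡⟨ sum-cong-≗ (λ i → sum-cong-≗ λ j → trans (sum-cong-≗ λ k → regroup (𝟙 (sel k)) (offDiagonal a i j) (y k i j))
                                                (sym (*-distribˡ-sum (offDiagonal a i j) (λ k → 𝟙 (sel k) ℤ.* y k i j)))) ⟩
  linFormℤ a (λ i j → subsetSum sel (λ k → y k i j)) ∎
  where
  open ≡-Reasoning
  term : Fin m → Fin n → Fin n → ℤ
  term k i j = offDiagonal a i j ℤ.* y k i j
  regroup : ∀ s b c → s ℤ.* (b ℤ.* c) ≡ b ℤ.* (s ℤ.* c)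
  regroup = solve-∀

linFormℤ-cong : ∀ {n} (a : Coeffs n) {y y′ : Fin n → Fin n → ℤ} → (∀ {i j} → i ≢ j → y i j ≡ y′ i j) →
  linFormℤ a y ≡ linFormℤ a y′
linFormℤ-cong a y≗y′ = sum-cong-≗ λ i → sum-cong-≗ λ j → entry i j
  where
  entry : ∀ i j → offDiagonal a i j ℤ.* _ ≡ offDiagonal a i j ℤ.* _
  entry i j with i Fin.≟ j
  ... | yes _   = refl
  ... | no  i≢j = cong (a i j ℤ.*_) (y≗y′ i≢j)

module Collapse {n m : ℕ} .{{_ : ℕ.NonZero m}} where

  class : Fin n → Fin m
  class i = toℕ i mod m

  member : 3 * m ≤ n → Fin m → Fin 3 → Fin n
  member 3m≤n k r = fromℕ< (ℕ.<-≤-trans (ℕ.+-mono-<-≤ (Fin.toℕ<n k) (ℕ.*-monoˡ-≤ m (ℕ.<⇒≤pred (Fin.toℕ<n r)))) 3m≤n)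

  member-injective : ∀ 3m≤n k → Injective _≡_ _≡_ (member 3m≤n k)
  member-injective 3m≤n k {r} {r′} eq = Fin.toℕ-injective (ℕ.*-cancelʳ-≡ (toℕ r) (toℕ r′) m
    (ℕ.+-cancelˡ-≡ (toℕ k) _ _ (trans (sym (Fin.toℕ-fromℕ< _)) (trans (cong toℕ eq) (Fin.toℕ-fromℕ< _)))))

  class-member : ∀ 3m≤n k r → class (member 3m≤n k r) ≡ k
  class-member 3m≤n k r = Fin.toℕ-injective (begin
    toℕ (class (member 3m≤n k r))       ≡⟨ Fin.toℕ-fromℕ< _ ⟩
    toℕ (member 3m≤n k r) ℕ.% m         ≡⟨ cong (ℕ._% m) (Fin.toℕ-fromℕ< _) ⟩
    (toℕ k + toℕ r * m) ℕ.% m           ≡⟨ [m+kn]%n≡m%n (toℕ k) (toℕ r) m ⟩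
    toℕ k ℕ.% m                         ≡⟨ m<n⇒m%n≡m (Fin.toℕ<n k) ⟩
    toℕ k ∎)
    where open ≡-Reasoning

  collapse : (Fin m → Bool) → Fin n → ℕ
  collapse sel i = if sel (class i) then toℕ (class i) else m + toℕ i

  collapse-selected : ∀ sel {i} → sel (class i) ≡ true → collapse sel i ≡ toℕ (class i)
  collapse-selected sel i∈ rewrite i∈ = refl

  class<offset : ∀ (i j : Fin n) → toℕ (class i) < m + toℕ j
  class<offset i j = ℕ.<-≤-trans (Fin.toℕ<n (class i)) (ℕ.m≤m+n m (toℕ j))

  collapse-tied : ∀ sel {i j} → i ≢ j → collapse sel i ≡ collapse sel j → sel (class i) ≡ true × class i ≡ class j
  collapse-tied sel {i} {j} i≢j tied with sel (class i) | sel (class j)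
  ... | true  | true  = refl , Fin.toℕ-injective tied
  ... | true  | false = ⊥-elim (ℕ.<-irrefl tied (class<offset i j))
  ... | false | true  = ⊥-elim (ℕ.<-irrefl (sym tied) (class<offset j i))
  ... | false | false = ⊥-elim (i≢j (Fin.toℕ-injective (ℕ.+-cancelˡ-≡ m _ _ tied)))

  member-selected : ∀ sel 3m≤n {k} → sel k ≡ true → ∀ r → sel (class (member 3m≤n k r)) ≡ true
  member-selected sel 3m≤n {k} k∈ r = trans (cong sel (class-member 3m≤n k r)) k∈

  collapse-three-below : ∀ sel → (∃[ k ] sel k ≡ true) → 3 * m ≤ n →
    ∀ j → ∃[ e ] Injective _≡_ _≡_ e × (∀ r → collapse sel (e r) ≤ collapse sel j)
  collapse-three-below sel (k , k∈) 3m≤n j with sel (class j) in j∈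
  ... | true  = member 3m≤n (class j) , member-injective 3m≤n (class j) , λ r →
    ℕ.≤-reflexive (trans (collapse-selected sel (member-selected sel 3m≤n j∈ r))
                         (cong toℕ (class-member 3m≤n (class j) r)))
  ... | false = member 3m≤n k , member-injective 3m≤n k , λ r →
    ℕ.<⇒≤ (subst (_< m + toℕ j) (sym (collapse-selected sel (member-selected sel 3m≤n k∈ r))) (class<offset _ j))

  sameSelectedClass : (Fin m → Bool) → Fin n → Fin n → ℤ
  sameSelectedClass sel i j = 𝟙 (sel (class i)) ℤ.* 𝟙 (does (class j Fin.≟ class i))

  sameSelectedClass-cases : ∀ sel i j →
    sameSelectedClass sel i j ≡ 0ℤ ⊎ (sel (class i) ≡ true × class j ≡ class i)
  sameSelectedClass-cases sel i j with sel (class i) | class j Fin.≟ class i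
  ... | false | _         = inj₁ refl
  ... | true  | no _      = inj₁ refl
  ... | true  | yes cj≡ci = inj₂ (refl , cj≡ci)

  untied⇒sameSelectedClass≡0 : ∀ sel {i j} → collapse sel i ≢ collapse sel j → sameSelectedClass sel i j ≡ 0ℤ
  untied⇒sameSelectedClass≡0 sel {i} {j} untied with sameSelectedClass-cases sel i j
  ... | inj₁ ≡0              = ≡0
  ... | inj₂ (i∈ , cj≡ci) = ⊥-elim (untied (begin
    collapse sel i    ≡⟨ collapse-selected sel i∈ ⟩
    toℕ (class i)     ≡⟨ cong toℕ (sym cj≡ci) ⟩
    toℕ (class j)     ≡⟨ collapse-selected sel (trans (cong sel cj≡ci) i∈) ⟨
    collapse sel j    ∎))
    where open ≡-Reasoning

  ties-collapse : ∀ sel {i j} → i ≢ j → ties (collapse sel) i j ≡ sameSelectedClass sel i j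
  ties-collapse sel {i} {j} i≢j with <-cmp (collapse sel i) (collapse sel j)
  ... | tri< _ untied _ = sym (untied⇒sameSelectedClass≡0 sel untied)
  ... | tri> _ untied _ = sym (untied⇒sameSelectedClass≡0 sel untied)
  ... | tri≈ _ tied _ with collapse-tied sel i≢j tied
  ...   | i∈ , ci≡cj rewrite i∈ | dec-true (class j Fin.≟ class i) (sym ci≡cj) = refl

  blockWeight : Coeffs n → Fin m → ℤ
  blockWeight a k = linFormℤ a (λ i j → 𝟙 (does (class i Fin.≟ k)) ℤ.* 𝟙 (does (class j Fin.≟ k)))

  linFormℤ-ties-collapse : ∀ a sel → linFormℤ a (ties (collapse sel)) ≡ subsetSum sel (blockWeight a)
  linFormℤ-ties-collapse a sel = begin
    linFormℤ a (ties (collapse sel))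
      ≡⟨ linFormℤ-cong a (ties-collapse sel) ⟩
    linFormℤ a (sameSelectedClass sel)
      ≡⟨ linFormℤ-cong a (λ {i} {j} _ → sym (selected-δ i j)) ⟩
    linFormℤ a (λ i j → subsetSum sel (λ k → 𝟙 (does (class i Fin.≟ k)) ℤ.* 𝟙 (does (class j Fin.≟ k))))
      ≡⟨ linFormℤ-subsetSum a sel _ ⟨
    subsetSum sel (blockWeight a) ∎
    where
    open ≡-Reasoning
    regroup : ∀ s b c → s ℤ.* (b ℤ.* c) ≡ b ℤ.* (s ℤ.* c)
    regroup = solve-∀
    selected-δ : ∀ i j → subsetSum sel (λ k → 𝟙 (does (class i Fin.≟ k)) ℤ.* 𝟙 (does (class j Fin.≟ k)))
                         ≡ sameSelectedClass sel i j
    selected-δ i j = trans (sum-cong-≗ λ k → regroup (𝟙 (sel k)) (𝟙 (does (class i Fin.≟ k))) (𝟙 (does (class j Fin.≟ k))))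
                           (∑-δ (class i) (λ k → 𝟙 (sel k) ℤ.* 𝟙 (does (class j Fin.≟ k))))

-- Walking down a refutation

queries : ∀ {n} → SPTree n → List (Coeffs n)
queries leaf           = []
queries (node a _ l r) = a ∷ queries l ++ queries r

length-queries : ∀ {n} (T : SPTree n) → length (queries T) ≡ size T
length-queries leaf           = refl
length-queries (node _ _ l r) = cong suc (trans (List.length-++ (queries l)) (cong₂ _+_ (length-queries l) (length-queries r)))

IntegralAt : ∀ {n} → Assignment n → Coeffs n → Set
IntegralAt x a = ∃[ w ] linForm a x ≡ toℚ w

branch-at-integral-point : ∀ {n} {x : Assignment n} a b → IntegralAt x a →
  toℚ b ℚ.≤ linForm a x ⊎ linForm a x ℚ.≤ toℚ (b ℤ.- 1ℤ)
branch-at-integral-point a b (w , a·x≡w) with b ℤ.≤? w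
... | yes b≤w = inj₁ (subst (toℚ b ℚ.≤_) (sym a·x≡w) (toℚ-mono-≤ b≤w))
... | no  b≰w = inj₂ (subst (ℚ._≤ toℚ (b ℤ.- 1ℤ)) (sym a·x≡w)
  (toℚ-mono-≤ (subst (w ℤ.≤_) (ℤ.+-comm (ℤ.- 1ℤ) b) (ℤ.i<j⇒i≤pred[j] (ℤ.≰⇒> b≰w)))))

valid-below-integral-point : ∀ {n} {C : Assignment n → Set} (T : SPTree n) → ValidBelow C T →
  ∀ {x} → LOPsat x → C x → All (IntegralAt x) (queries T) → ⊥
valid-below-integral-point leaf infeasible sat Cx _ = infeasible _ sat Cx
valid-below-integral-point (node a b l r) (valid-l , valid-r) sat Cx (a-integral ∷ rest)
  with All.++⁻ (queries l) rest | branch-at-integral-point a b a-integral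
... | integral-l , _ | inj₁ above = valid-below-integral-point l valid-l sat (Cx , above) integral-l
... | _ , integral-r | inj₂ below = valid-below-integral-point r valid-r sat (Cx , below) integral-r

integral-LOP-point : ∀ {n} (qs : List (Coeffs n)) → 3 * suc (length qs) ≤ n →
  ∃[ x ] LOPsat x × All (IntegralAt x) qs
integral-LOP-point {n} qs 3m≤n =
  rankPoint (collapse sel) ,
  rankPoint-LOPsat (collapse sel) (collapse-three-below sel nonempty 3m≤n) ,
  subst (All (IntegralAt (rankPoint (collapse sel)))) (List.tabulate-lookup qs) (All.tabulate⁺ integral)
  where
  open Collapse {n} {suc (length qs)}
  choice = nonempty-even-subsetSum (ℕ.n<1+n (length qs)) (λ k t → blockWeight (lookup qs t) k)
  sel = proj₁ choice
  nonempty = proj₁ (proj₂ choice)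
  integral : ∀ t → IntegralAt (rankPoint (collapse sel)) (lookup qs t)
  integral t = rankPoint-integral (collapse sel) (lookup qs t)
    (subst Even (sym (linFormℤ-ties-collapse (lookup qs t) sel)) (proj₂ (proj₂ choice) t))

LOP-refutation-size : ∀ {n} (T : SPTree n) → IsSPRefutationLOP T → n < 3 * suc (size T)
LOP-refutation-size {n} T refutes = ℕ.≰⇒> λ 3m≤n →
  let x , sat , integral = integral-LOP-point (queries T) (subst (λ s → 3 * suc s ≤ n) (sym (length-queries T)) 3m≤n)
  in valid-below-integral-point T refutes sat tt integral

^-distrib-* : ∀ a b k → (a * b) ^ k ≡ a ^ k * b ^ k
^-distrib-* a b zero    = refl
^-distrib-* a b (suc k) rewrite ^-distrib-* a b k = interchange a b (a ^ k) (b ^ k)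
  where
  interchange : ∀ a b x y → a * b * (x * y) ≡ a * x * (b * y)
  interchange = solve-ℕ

linear⇒polynomial-bound : ∀ p q {n s} → 3 ≤ n → n < 3 * suc s → n ^ q ≤ 6 ^ q * s ^ (4 * q) * n ^ p
linear⇒polynomial-bound p q {n} {zero} 3≤n n<3 = ⊥-elim (ℕ.<-irrefl refl (ℕ.<-≤-trans n<3 3≤n))
linear⇒polynomial-bound p q {suc n} {s@(suc _)} _ n<3[1+s] = begin
  suc n ^ q                      ≤⟨ ℕ.^-monoˡ-≤ q n≤6s ⟩
  (6 * s) ^ q                    ≡⟨ ^-distrib-* 6 s q ⟩
  6 ^ q * s ^ q                  ≤⟨ ℕ.*-monoʳ-≤ (6 ^ q) (ℕ.^-monoʳ-≤ s (ℕ.m≤n*m q 4)) ⟩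
  6 ^ q * s ^ (4 * q)            ≡⟨ ℕ.*-identityʳ _ ⟨
  6 ^ q * s ^ (4 * q) * 1        ≤⟨ ℕ.*-monoʳ-≤ (6 ^ q * s ^ (4 * q)) (ℕ.m^n>0 (suc n) p) ⟩
  6 ^ q * s ^ (4 * q) * suc n ^ p ∎
  where
  open ℕ.≤-Reasoning
  n≤6s : suc n ≤ 6 * s
  n≤6s = ℕ.≤-trans (ℕ.<⇒≤ n<3[1+s]) (ℕ.≤-trans (ℕ.*-monoʳ-≤ 3 (s≤s (ℕ.m≤n+m s _))) (ℕ.≤-reflexive (double s)))
    where
    double : ∀ s → 3 * (s + s) ≡ 6 * s
    double = solve-ℕ

mainTheorem6 : (p q : ℕ) → 0 < p → 0 < q →
    Σ ℕ λ d → Σ ℕ λ N → (0 < d) ×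
      ((n : ℕ) → N ≤ n → (T : SPTree n) → IsSPRefutationLOP T →
        n ^ q ≤ d * (size T ^ (4 * q)) * n ^ p)
mainTheorem6 p q _ _ = 6 ^ q , 3 , ℕ.m^n>0 6 q ,
  λ n 3≤n T refutes → linear⇒polynomial-bound p q 3≤n (LOP-refutation-size T refutes)
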